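{- For any integer $k \ge 2$, the equation $n/Z(n) = k$ has infinitely many solutions in positive integers $n$.
   Context: For a positive integer $m$ let $T(m) = m(m+1)/2$ denote the $m$-th triangular number. The pseudo-Smarandache function is defined for positive integers $n$ by $Z(n) = \min\{ m \ge 1 : n \mid T(m) \}$. -}

module Defs where

open import Data.Nat using (ℕ; suc; _*_; _≤_; _<_)
open import Data.Nat.Divisibility using (_∣_)
open import Data.Nat.DivMod using (_/_)
open import Data.Product using (_×_)

T : ℕ → ℕ
T m = (m * suc m) / 2

-- IsZ n m : m = Z(n) = min { m ≥ 1 : n ∣ T(m) }
IsZ : ℕ → ℕ → Set
IsZ n m = (1 ≤ m) × (n ∣ T m) × (∀ m′ → 1 ≤ m′ → n ∣ T m′ → m ≤ m′)

{-# OPTIONS --safe #-}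
-- Write 2k − 1 = q·M with q = p^e (e ≥ 1) the full power of some prime p dividing it, and put
-- L = 2kM = (qM + 1)M, which is prime to p. Since p has finite order modulo L, there are
-- arbitrarily large powers P = p^a ≡ q (mod L). For m = MP we get m + 1 ≡ qM + 1 = 2k (mod L),
-- so n = km divides T(m). If x < m also had 2n = LP ∣ x(x + 1), the prime power P would divide
-- x or x + 1, i.e. x = iP or x + 1 = iP with i ≤ M; reducing P to q modulo L leaves L dividing
-- (qi ± 1)·i, a positive number below (qM + 1)M = L.
module Submission where

open import Defs
open import Data.Nat using (ℕ; _*_; _≤_; _<_)
open import Data.Product using (_×_; ∃-syntax)
open import Relation.Binary.PropositionalEquality using (_≡_)

open import Data.Nat.Base
open import Data.Nat.Properties
open import Data.Nat.Divisibility
open import Data.Nat.DivMod using (_/_; _%_; _mod_; m/n*n≡m; m≡m%n+[m/n]*n)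
open import Data.Nat.Primality using (Prime; euclidsLemma; prime⇒irreducible; prime⇒nonZero; prime⇒nonTrivial; ¬prime[1])
open import Data.Nat.Primality.Factorisation using (factorise; PrimeFactorisation)
open import Data.Nat.ListAction using (product)
open import Data.Nat.Coprimality using (Coprime; coprime-divisor)
open import Data.Nat.Induction using (<-wellFounded)
open import Data.Nat.Tactic.RingSolver using (solve-∀)
open import Data.Fin using (toℕ)
open import Data.Fin.Properties using (pigeonhole; fromℕ<-injective)
open import Data.List.Base using ([]; _∷_)
open import Data.List.Relation.Unary.All using (All; _∷_)
open import Data.Product using (_,_)
open import Data.Sum using (_⊎_; inj₁; inj₂)
open import Induction.WellFounded using (Acc; acc)
open import Relation.Nullary using (yes; no; contradiction)
open import Relation.Binary.PropositionalEquality using (refl; sym; trans; cong; cong₂; subst; module ≡-Reasoning)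

private
  variable
    a m n p : ℕ

2∣n*[1+n] : ∀ n → 2 ∣ n * suc n
2∣n*[1+n] zero    = 2 ∣0
2∣n*[1+n] (suc n) = subst (2 ∣_) (step n) (∣m∣n⇒∣m+n (2∣n*[1+n] n) (n∣m*n (suc n)))
  where
  step : ∀ n → n * suc n + suc n * 2 ≡ suc n * suc (suc n)
  step = solve-∀

T*2≡n*[1+n] : ∀ n → T n * 2 ≡ n * suc n
T*2≡n*[1+n] n = m/n*n≡m (2∣n*[1+n] n)

∣T⇒*2∣ : ∀ n → m ∣ T n → m * 2 ∣ n * suc n
∣T⇒*2∣ {m} n m∣Tn = subst (m * 2 ∣_) (T*2≡n*[1+n] n) (*-monoˡ-∣ 2 m∣Tn)

*2∣⇒∣T : ∀ n → m * 2 ∣ n * suc n → m ∣ T n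
*2∣⇒∣T {m} n m*2∣ = *-cancelʳ-∣ 2 (subst (m * 2 ∣_) (sym (T*2≡n*[1+n] n)) m*2∣)

n<m^n : 1 < m → ∀ n → n < m ^ n
n<m^n 1<m zero    = z<s
n<m^n 1<m (suc n) = <-≤-trans (s≤s (n<m^n 1<m n)) (^-monoʳ-< _ 1<m (n<1+n n))

prime>1 : Prime p → 1 < p
prime>1 {p} p-prime = nonTrivial⇒n>1 p {{prime⇒nonTrivial p-prime}}

prime-factor : 1 < n → ∃[ p ] (Prime p × p ∣ n)
prime-factor {n@(suc _)} 1<n = first (factors f) (isFactorisation f) (factorsPrime f)
  where
  open PrimeFactorisation
  f : PrimeFactorisation n
  f = factorise n
  first : ∀ ps → n ≡ product ps → All Prime ps → ∃[ p ] (Prime p × p ∣ n)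
  first []       n≡1    _             = contradiction (sym n≡1) (<⇒≢ 1<n)
  first (p ∷ ps) n≡p*ps (p-prime ∷ _) = p , p-prime , divides (product ps) (trans n≡p*ps (*-comm p (product ps)))

p-part : 1 < p → ∀ n .{{_ : NonZero n}} → ∃[ e ] ∃[ m ] (n ≡ p ^ e * m × p ∤ m)
p-part {p} 1<p n = split n (<-wellFounded n)
  where
  split : ∀ n .{{_ : NonZero n}} → Acc _<_ n → ∃[ e ] ∃[ m ] (n ≡ p ^ e * m × p ∤ m)
  split n (acc rec) with p ∣? n
  ... | no p∤n = 0 , n , sym (*-identityˡ n) , p∤n
  ... | yes (divides n′ refl) with split n′ {{m*n≢0⇒m≢0 n′}} (rec (m<m*n n′ p {{m*n≢0⇒m≢0 n′}} 1<p))
  ...   | e , m , n′≡p^e*m , p∤m =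
    suc e , m , trans (cong (_* p) n′≡p^e*m) (trans (*-comm _ p) (sym (*-assoc p (p ^ e) m))) , p∤m

prime∣⇒∤suc : Prime p → p ∣ n → p ∤ suc n
prime∣⇒∤suc {p} {n} p-prime p∣n p∣1+n =
  ¬prime[1] (subst Prime (∣1⇒≡1 (∣m+n∣m⇒∣n (subst (p ∣_) (+-comm 1 n) p∣1+n) p∣n)) p-prime)

prime∤⇒coprime : Prime p → p ∤ n → Coprime n p
prime∤⇒coprime p-prime p∤n (d∣n , d∣p) with prime⇒irreducible p-prime d∣p
... | inj₁ d≡1 = d≡1
... | inj₂ refl = contradiction d∣n p∤n

∣p^i*n⇒∣n : Prime p → p ∤ m → ∀ i → m ∣ p ^ i * n → m ∣ n
∣p^i*n⇒∣n {n = n} _ _ zero m∣ = subst (_ ∣_) (*-identityˡ n) m∣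
∣p^i*n⇒∣n {p} {m} {n} p-prime p∤m (suc i) m∣ = ∣p^i*n⇒∣n p-prime p∤m i
  (coprime-divisor (prime∤⇒coprime p-prime p∤m) (subst (m ∣_) (*-assoc p (p ^ i) n) m∣))

p^a∣m*n⇒p^a∣m : Prime p → p ∤ n → ∀ a → p ^ a ∣ m * n → p ^ a ∣ m
p^a∣m*n⇒p^a∣m {m = m} _ _ zero _ = 1∣ m
p^a∣m*n⇒p^a∣m {p} {n} {m} p-prime p∤n (suc a) p^a+1∣
  with euclidsLemma m n p-prime (∣-trans (m∣m*n (p ^ a)) p^a+1∣)
... | inj₂ p∣n = contradiction p∣n p∤n
... | inj₁ (divides m′ refl) = subst (p * p ^ a ∣_) (*-comm p m′) (*-monoʳ-∣ p p^a∣m′)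
  where
  instance
    p≢0 : NonZero p
    p≢0 = prime⇒nonZero p-prime
  shuffle : ∀ m′ p n → m′ * p * n ≡ p * (m′ * n)
  shuffle = solve-∀
  p^a∣m′ : p ^ a ∣ m′
  p^a∣m′ = p^a∣m*n⇒p^a∣m p-prime p∤n a (*-cancelˡ-∣ p (subst (p ^ suc a ∣_) (shuffle m′ p n) p^a+1∣))

p^a∣consecutive : Prime p → p ^ a ∣ n * suc n → p ^ a ∣ n ⊎ p ^ a ∣ suc n
p^a∣consecutive {p} {a} {n} p-prime p^a∣ with p ∣? n
... | yes p∣n = inj₁ (p^a∣m*n⇒p^a∣m p-prime (prime∣⇒∤suc p-prime p∣n) a p^a∣)
... | no  p∤n = inj₂ (p^a∣m*n⇒p^a∣m p-prime p∤n a (subst (p ^ a ∣_) (*-comm n (suc n)) p^a∣))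

%≡%⇒∣∸ : ∀ {m n} L .{{_ : NonZero L}} → m % L ≡ n % L → L ∣ n ∸ m
%≡%⇒∣∸ {m} {n} L m%L≡n%L = divides (n / L ∸ m / L) (begin
  n ∸ m                                       ≡⟨ cong₂ _∸_ (m≡m%n+[m/n]*n n L) (m≡m%n+[m/n]*n m L) ⟩
  (n % L + n / L * L) ∸ (m % L + m / L * L)   ≡⟨ cong (λ r → (n % L + n / L * L) ∸ (r + m / L * L)) m%L≡n%L ⟩
  (n % L + n / L * L) ∸ (n % L + m / L * L)   ≡⟨ [m+n]∸[m+o]≡n∸o (n % L) _ _ ⟩
  n / L * L ∸ m / L * L                       ≡⟨ sym (*-distribʳ-∸ L (n / L) (m / L)) ⟩
  (n / L ∸ m / L) * L                         ∎)
  where open ≡-Reasoning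

p^d≡1+s*L : ∀ {L} → Prime p → p ∤ L → .{{_ : NonZero L}} → ∃[ d ] (1 ≤ d × ∃[ s ] (p ^ d ≡ 1 + s * L))
p^d≡1+s*L {p} {L} p-prime p∤L with pigeonhole (n<1+n L) (λ i → p ^ toℕ i mod L)
... | i , j , i<j , p^i≡p^j = d , m<n⇒0<n∸m i<j , quotient L∣p^d∸1 , p^d≡1+sL
  where
  d : ℕ
  d = toℕ j ∸ toℕ i
  p^j∸p^i : p ^ toℕ j ∸ p ^ toℕ i ≡ p ^ toℕ i * (p ^ d ∸ 1)
  p^j∸p^i = begin
    p ^ toℕ j ∸ p ^ toℕ i               ≡⟨ cong₂ _∸_ (cong (p ^_) (sym (m+[n∸m]≡n (<⇒≤ i<j)))) (sym (*-identityʳ (p ^ toℕ i))) ⟩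
    p ^ (toℕ i + d) ∸ p ^ toℕ i * 1     ≡⟨ cong (_∸ p ^ toℕ i * 1) (^-distribˡ-+-* p (toℕ i) d) ⟩
    p ^ toℕ i * p ^ d ∸ p ^ toℕ i * 1   ≡⟨ sym (*-distribˡ-∸ (p ^ toℕ i) (p ^ d) 1) ⟩
    p ^ toℕ i * (p ^ d ∸ 1)             ∎
    where open ≡-Reasoning
  L∣p^d∸1 : L ∣ p ^ d ∸ 1
  L∣p^d∸1 = ∣p^i*n⇒∣n p-prime p∤L (toℕ i)
    (subst (L ∣_) p^j∸p^i (%≡%⇒∣∸ L (fromℕ<-injective _ _ _ _ p^i≡p^j)))
  p^d≡1+sL : p ^ d ≡ 1 + quotient L∣p^d∸1 * L
  p^d≡1+sL = trans (sym (m+[n∸m]≡n (m^n>0 p {{prime⇒nonZero p-prime}} d)))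
                   (cong (1 +_) (m∣n⇒n≡quotient*m L∣p^d∸1))

[1+s*L]^n≡1+t*L : ∀ s L n → ∃[ t ] ((1 + s * L) ^ n ≡ 1 + t * L)
[1+s*L]^n≡1+t*L s L zero    = 0 , refl
[1+s*L]^n≡1+t*L s L (suc n) with [1+s*L]^n≡1+t*L s L n
... | t , eq = s + t + s * t * L , trans (cong ((1 + s * L) *_) eq) (expand s t L)
  where
  expand : ∀ s t L → (1 + s * L) * (1 + t * L) ≡ 1 + (s + t + s * t * L) * L
  expand = solve-∀

∤[m+t*L]*n : ∀ {L} t → 0 < m * n → m * n < L → L ∤ (m + t * L) * n
∤[m+t*L]*n {m} {n} {L} t 0<mn mn<L L∣ =
  >⇒∤ {{>-nonZero 0<mn}} mn<L (∣m+n∣m⇒∣n (subst (L ∣_) (expand m t L n) L∣) (n∣m*n (t * n)))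
  where
  expand : ∀ m t L n → (m + t * L) * n ≡ t * n * L + m * n
  expand = solve-∀

module _ {k p e M : ℕ} (p-prime : Prime p) (p∤M : p ∤ M) .{{_ : NonZero M}}
         (k*2≡1+qM : k * 2 ≡ suc (p ^ suc e * M)) where

  private
    q : ℕ
    q = p ^ suc e

    L : ℕ
    L = k * 2 * M

    instance
      p≢0 : NonZero p
      p≢0 = prime⇒nonZero p-prime

      q≢0 : NonZero q
      q≢0 = m^n≢0 p (suc e)

      k*2≢0 : NonZero (k * 2)
      k*2≢0 = subst NonZero (sym k*2≡1+qM) _

      k≢0 : NonZero k
      k≢0 = m*n≢0⇒m≢0 k

      L≢0 : NonZero L
      L≢0 = m*n≢0 (k * 2) M

  q>1 : 1 < q
  q>1 = <-≤-trans (prime>1 p-prime) (m≤m*n p (p ^ e) {{m^n≢0 p e}})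

  p∤L : p ∤ L
  p∤L p∣L with euclidsLemma (k * 2) M p-prime p∣L
  ... | inj₁ p∣k*2 = prime∣⇒∤suc p-prime (∣m⇒∣m*n M (m∣m*n (p ^ e))) (subst (p ∣_) k*2≡1+qM p∣k*2)
  ... | inj₂ p∣M   = p∤M p∣M

  L∤[y+t*L]*i : ∀ {y i} t → 0 < y * i → y < suc (q * M) → i ≤ M → L ∤ (y + t * L) * i
  L∤[y+t*L]*i {y} {i} t 0<yi y<1+qM i≤M = ∤[m+t*L]*n {y} {i} t 0<yi (begin-strict
    y * i            ≤⟨ *-monoʳ-≤ y i≤M ⟩
    y * M            <⟨ *-monoˡ-< M y<1+qM ⟩
    suc (q * M) * M  ≡⟨ cong (_* M) k*2≡1+qM ⟨
    L                ∎)
    where open ≤-Reasoning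

  module _ {a t : ℕ} (p^a≡q+tL : p ^ a ≡ q + t * L) where

    private
      P : ℕ
      P = p ^ a

      instance
        P≢0 : NonZero P
        P≢0 = m^n≢0 p a

    1+MP≡k*2*[1+MtM] : suc (M * P) ≡ k * 2 * (1 + M * t * M)
    1+MP≡k*2*[1+MtM] = begin
      suc (M * P)                        ≡⟨ cong (λ P → suc (M * P)) p^a≡q+tL ⟩
      suc (M * (q + t * (k * 2 * M)))    ≡⟨ expand q M t (k * 2) ⟩
      suc (q * M) + k * 2 * (M * t * M)  ≡⟨ cong (_+ k * 2 * (M * t * M)) k*2≡1+qM ⟨
      k * 2 + k * 2 * (M * t * M)        ≡⟨ factor (k * 2) (M * t * M) ⟩
      k * 2 * (1 + M * t * M)            ∎
      where
      open ≡-Reasoning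
      expand : ∀ q M t K → suc (M * (q + t * (K * M))) ≡ suc (q * M) + K * (M * t * M)
      expand = solve-∀
      factor : ∀ K w → K + K * w ≡ K * (1 + w)
      factor = solve-∀

    k*MP∣T[MP] : k * (M * P) ∣ T (M * P)
    k*MP∣T[MP] = *2∣⇒∣T (M * P) (divides (1 + M * t * M)
      (trans (cong (M * P *_) 1+MP≡k*2*[1+MtM]) (shuffle (M * P) k (1 + M * t * M))))
      where
      shuffle : ∀ m k w → m * (k * 2 * w) ≡ w * (k * m * 2)
      shuffle = solve-∀

    L∤[1+iP]*i : ∀ {i} → 1 ≤ i → i < M → L ∤ suc (i * P) * i
    L∤[1+iP]*i {i} 1≤i i<M = subst (λ y → L ∤ y * i) (sym 1+iP≡)
      (L∤[y+t*L]*i (i * t) (*-mono-≤ (z<s {n = q * i}) 1≤i) (s≤s (*-monoʳ-< q i<M)) (<⇒≤ i<M))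
      where
      expand : ∀ i q t L → suc (i * (q + t * L)) ≡ suc (q * i) + i * t * L
      expand = solve-∀
      1+iP≡ : suc (i * P) ≡ suc (q * i) + i * t * L
      1+iP≡ = trans (cong (λ P → suc (i * P)) p^a≡q+tL) (expand i q t L)

    L∤[iP∸1]*i : ∀ {i} → 1 ≤ i → i ≤ M → L ∤ (i * P ∸ 1) * i
    L∤[iP∸1]*i {i} 1≤i i≤M = subst (λ y → L ∤ y * i) (sym iP∸1≡)
      (L∤[y+t*L]*i (i * t) (*-mono-≤ (m<n⇒0<n∸m 1<q*i) 1≤i) q*i∸1<1+qM i≤M)
      where
      expand : ∀ i q t L → i * (q + t * L) ≡ q * i + i * t * L
      expand = solve-∀
      1<q*i : 1 < q * i
      1<q*i = <-≤-trans q>1 (m≤m*n q i {{>-nonZero 1≤i}})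
      q*i∸1<1+qM : q * i ∸ 1 < suc (q * M)
      q*i∸1<1+qM = s≤s (≤-trans (m∸n≤m (q * i) 1) (*-monoʳ-≤ q i≤M))
      iP∸1≡ : i * P ∸ 1 ≡ q * i ∸ 1 + i * t * L
      iP∸1≡ = trans (cong (λ P → i * P ∸ 1) p^a≡q+tL)
                    (trans (cong (_∸ 1) (expand i q t L)) (+-∸-comm (i * t * L) (<⇒≤ 1<q*i)))

    LP∤x*[1+x] : ∀ {x} → 1 ≤ x → x < M * P → L * P ∤ x * suc x
    LP∤x*[1+x] {x} 1≤x x<MP LP∣ with p^a∣consecutive {a = a} {n = x} p-prime (∣-trans (n∣m*n L) LP∣)
    ... | inj₁ (divides i refl) =
      L∤[1+iP]*i 1≤i (*-cancelʳ-< P i M x<MP) (*-cancelʳ-∣ P (subst (L * P ∣_) (rearrange i P) LP∣))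
      where
      rearrange : ∀ i P → i * P * suc (i * P) ≡ suc (i * P) * i * P
      rearrange = solve-∀
      1≤i : 1 ≤ i
      1≤i = >-nonZero⁻¹ i {{m*n≢0⇒m≢0 i {{>-nonZero 1≤x}}}}
    ... | inj₂ (divides i 1+x≡iP) =
      L∤[iP∸1]*i 1≤i (*-cancelʳ-≤ i M P (subst (_≤ M * P) 1+x≡iP x<MP))
        (subst (λ x → L ∣ x * i) (cong (_∸ 1) 1+x≡iP) (*-cancelʳ-∣ P L*P∣x*i*P))
      where
      L*P∣x*i*P : L * P ∣ x * i * P
      L*P∣x*i*P = subst (L * P ∣_) (trans (cong (x *_) 1+x≡iP) (sym (*-assoc x i P))) LP∣
      1≤i : 1 ≤ i
      1≤i = >-nonZero⁻¹ i {{m*n≢0⇒m≢0 i {{subst NonZero 1+x≡iP _}}}}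

    IsZ[k*MP][MP] : IsZ (k * (M * P)) (M * P)
    IsZ[k*MP][MP] = >-nonZero⁻¹ (M * P) {{m*n≢0 M P}} , k*MP∣T[MP] , minimal
      where
      shuffle : ∀ k M P → k * (M * P) * 2 ≡ k * 2 * M * P
      shuffle = solve-∀
      minimal : ∀ x → 1 ≤ x → k * (M * P) ∣ T x → M * P ≤ x
      minimal x 1≤x n∣Tx = ≮⇒≥ λ x<MP →
        LP∤x*[1+x] 1≤x x<MP (subst (_∣ x * suc x) (shuffle k M P) (∣T⇒*2∣ x n∣Tx))

  large-p^a≡q+tL : ∀ N → ∃[ a ] ∃[ t ] (N < p ^ a × p ^ a ≡ q + t * L)
  large-p^a≡q+tL N with p^d≡1+s*L p-prime p∤L
  ... | d , 1≤d , s , p^d≡1+sL with [1+s*L]^n≡1+t*L s L N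
  ...   | t , [1+sL]^N≡1+tL = suc e + d * N , q * t , N<p^a , p^a≡
    where
    N<p^a : N < p ^ (suc e + d * N)
    N<p^a = <-≤-trans (n<m^n (prime>1 p-prime) N)
      (^-monoʳ-≤ p (≤-trans (m≤n*m N d {{>-nonZero 1≤d}}) (m≤n+m (d * N) (suc e))))
    p^a≡ : p ^ (suc e + d * N) ≡ q + q * t * L
    p^a≡ = begin
      p ^ (suc e + d * N)  ≡⟨ ^-distribˡ-+-* p (suc e) (d * N) ⟩
      q * p ^ (d * N)      ≡⟨ cong (q *_) (^-*-assoc p d N) ⟨
      q * (p ^ d) ^ N      ≡⟨ cong (λ v → q * v ^ N) p^d≡1+sL ⟩
      q * (1 + s * L) ^ N  ≡⟨ cong (q *_) [1+sL]^N≡1+tL ⟩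
      q * (1 + t * L)      ≡⟨ expand q t L ⟩
      q + q * t * L        ∎
      where
      open ≡-Reasoning
      expand : ∀ q t L → q * (1 + t * L) ≡ q + q * t * L
      expand = solve-∀

  arbitrarily-large-solutions : ∀ N → ∃[ n ] (N < n × ∃[ m ] (IsZ n m × n ≡ k * m))
  arbitrarily-large-solutions N =
    let a , t , N<p^a , p^a≡q+tL = large-p^a≡q+tL N
        N<n : N < k * (M * p ^ a)
        N<n = <-≤-trans N<p^a (≤-trans (m≤n*m (p ^ a) M) (m≤n*m (M * p ^ a) k))
    in k * (M * p ^ a) , N<n , M * p ^ a , IsZ[k*MP][MP] {a} {t} p^a≡q+tL , refl

theorem2 : ∀ (k : ℕ) → 2 ≤ k →
    ∀ (N : ℕ) → ∃[ n ] (N < n × ∃[ m ] (IsZ n m × n ≡ k * m))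
theorem2 k@(suc k′) (s≤s 1≤k′) N with prime-factor {suc (k′ * 2)} (s≤s (≤-trans 1≤k′ (m≤m*n k′ 2)))
... | p , p-prime , p∣2k-1 with p-part (prime>1 p-prime) (suc (k′ * 2))
...   | zero , M , 2k-1≡M , p∤M = contradiction (subst (p ∣_) (trans 2k-1≡M (*-identityˡ M)) p∣2k-1) p∤M
...   | suc e , M , 2k-1≡qM , p∤M =
  arbitrarily-large-solutions {k} {p} {e} {M} p-prime p∤M {{M≢0}} (cong suc 2k-1≡qM) N
  where
  M≢0 : NonZero M
  M≢0 = m*n≢0⇒n≢0 (p ^ suc e) {{subst NonZero 2k-1≡qM _}}
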